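{- Let $\mathbb{A}$ be a nonnegative strongly primitive tensor of order $m$ and dimension $n$ and let $k=\eta(\mathbb{A})$. Then for every integer $t>k$, $\mathbb{A}^t$ is a positive tensor.
   Context: General product: for $\mathbb{A}=(a_{i_1\ldots i_m})$ of order $m\ge2$ and $\mathbb{B}$ of order $k\ge1$, both of dimension $n$, $\mathbb{A}\mathbb{B}$ is the order $(m-1)(k-1)+1$, dimension $n$ tensor with $(\mathbb{A}\mathbb{B})_{i\alpha_1\ldots\alpha_{m-1}}=\sum_{i_2,\ldots,i_m=1}^n a_{ii_2\ldots i_m}b_{i_2\alpha_1}\cdots b_{i_m\alpha_{m-1}}$ ($i\in[n]$, $\alpha_j\in[n]^{k-1}$). It is associative; $\mathbb{A}^1=\mathbb{A}$, $\mathbb{A}^k=\mathbb{A}\mathbb{A}^{k-1}$. A nonnegative tensor $\mathbb{A}$ is strongly primitive if $\mathbb{A}^k$ is positive (all entries $>0$) for some positive integer $k$; the least such $k$ is the strongly primitive degree $\eta(\mathbb{A})$.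
   Formalization: The tensor $\mathbb{A}$ has rational entries. -}

module Defs where

open import Data.Nat using (ℕ; zero; suc; _*_; _≤_; _<_)
open import Data.Fin using (Fin)
open import Data.Vec using (Vec; []; _∷_; splitAt)
open import Data.Product using (_×_; ∃-syntax; proj₁; proj₂)
open import Data.Rational using (ℚ; 0ℚ; 1ℚ; _+_) renaming (_*_ to _*ℚ_; _≤_ to _≤ℚ_; _<_ to _<ℚ_)
open import Relation.Nullary using (¬_)
open import Data.Empty using (⊥)

-- A (real) tensor of order r and dimension n: entries indexed by Vec (Fin n) r.
-- Entries are taken in ℚ (no reals in agda-stdlib).
Tensor : ℕ → ℕ → Set
Tensor n r = Vec (Fin n) r → ℚ

sumFin : (n : ℕ) → (Fin n → ℚ) → ℚ
sumFin zero    f = 0ℚ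
sumFin (suc n) f = f Fin.zero + sumFin n (λ i → f (Fin.suc i))

sumVec : (n d : ℕ) → (Vec (Fin n) d → ℚ) → ℚ
sumVec n zero    f = f []
sumVec n (suc d) f = sumFin n (λ i → sumVec n d (λ v → f (i ∷ v)))

chunks : ∀ {A : Set} (d q : ℕ) → Vec A (d * q) → Vec (Vec A q) d
chunks zero    q xs = []
chunks (suc d) q xs = proj₁ (splitAt q xs) ∷ chunks d q (proj₁ (proj₂ (splitAt q xs)))

prodBlocks : ∀ {n q} (d : ℕ) → Tensor n (suc q) → Vec (Fin n) d → Vec (Vec (Fin n) q) d → ℚ
prodBlocks zero    B []       []       = 1ℚ
prodBlocks (suc d) B (i ∷ is) (α ∷ αs) = B (i ∷ α) *ℚ prodBlocks d B is αs

-- General product: A of order m = suc d, B of order k = suc q;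
-- AB has order (m-1)(k-1)+1 = suc (d * q).
_⊗_ : ∀ {n d q} → Tensor n (suc d) → Tensor n (suc q) → Tensor n (suc (d * q))
_⊗_ {n} {d} {q} A B (i ∷ α) =
  sumVec n d (λ is → A (i ∷ is) *ℚ prodBlocks d B is (chunks d q α))

powOrd : ℕ → ℕ → ℕ
powOrd d zero    = d
powOrd d (suc j) = d * powOrd d j

-- A ^[1+ j ] is the power A^(j+1):  A^1 = A,  A^(j+2) = A A^(j+1)
_^[1+_] : ∀ {n d} → Tensor n (suc d) → (j : ℕ) → Tensor n (suc (powOrd d j))
A ^[1+ zero ]  = A
A ^[1+ suc j ] = A ⊗ (A ^[1+ j ])

Nonnegative : ∀ {n r} → Tensor n r → Set
Nonnegative A = ∀ idx → 0ℚ ≤ℚ A idx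

Positive : ∀ {n r} → Tensor n r → Set
Positive A = ∀ idx → 0ℚ <ℚ A idx

-- "A^k is positive" for an exponent k; only exponents k ≥ 1 are meaningful
-- (A^0 is not defined in the paper); every use below also requires 1 ≤ k.
PositivePower : ∀ {n d} → Tensor n (suc d) → ℕ → Set
PositivePower A zero    = ⊥
PositivePower A (suc j) = Positive (A ^[1+ j ])

StronglyPrimitive : ∀ {n d} → Tensor n (suc d) → Set
StronglyPrimitive A = ∃[ k ] (1 ≤ k × PositivePower A k)

IsStronglyPrimitiveDegree : ∀ {n d} → Tensor n (suc d) → ℕ → Set
IsStronglyPrimitiveDegree A k =
  1 ≤ k × PositivePower A k × (∀ j → 1 ≤ j → j < k → ¬ PositivePower A j)

{-# OPTIONS --safe #-}
module Submission where

-- For nonnegative A, an entry (A B)(i,α) is a sum of terms A(i,i₂…i_m) B(i₂,α₁)⋯B(i_m,α_{m-1})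
-- with nonnegative first factor. Hence if some entry in row i of A B is positive (e.g. B = A^(k-1)
-- with A^k positive), the row A(i,·) has a positive entry; and if every row of A has one and B is
-- positive, every entry of A B contains a positive term. With B = A^t this propagates positivity
-- from A^k to all higher powers.

open import Defs
open import Data.Nat using (ℕ; zero; suc; _≤_; _<_; _≤′_; ≤′-refl; ≤′-step; s≤s)
open import Data.Nat.Properties using (<⇒≤; ≤⇒≤′)
open import Data.Fin using (Fin)
open import Data.Vec using (Vec; []; _∷_; replicate)
open import Data.Product using (_,_; ∃-syntax)
open import Data.Sum using (_⊎_; inj₁; inj₂)
open import Data.Empty using (⊥-elim)
open import Relation.Nullary using (yes; no)
open import Relation.Binary.PropositionalEquality using (refl; sym; subst)
open import Data.Rational
  using (ℚ; 0ℚ; 1ℚ; _+_; positive; nonNegative)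
  renaming (_*_ to _*ℚ_; _≤_ to _≤ℚ_; _<_ to _<ℚ_)
open import Data.Rational.Properties
  using ( positive⁻¹; nonNegative⁻¹; pos*pos⇒pos; nonNeg*nonNeg⇒nonNeg
        ; pos+nonNeg⇒pos; nonNeg+pos⇒pos; nonNeg+nonNeg⇒nonNeg
        ; _<?_; ≮⇒≥; ≤-antisym; <-≤-trans; <-irrefl; ≤-refl
        ; +-monoˡ-≤; +-identityˡ; *-zeroˡ)
  renaming (<⇒≤ to <⇒≤ℚ)

private
  variable
    n d q : ℕ

*-pos : ∀ {p r} → 0ℚ <ℚ p → 0ℚ <ℚ r → 0ℚ <ℚ p *ℚ r
*-pos {p} {r} 0<p 0<r =
  positive⁻¹ (p *ℚ r) {{pos*pos⇒pos p {{positive 0<p}} r {{positive 0<r}}}}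

*-nonNeg : ∀ {p r} → 0ℚ ≤ℚ p → 0ℚ ≤ℚ r → 0ℚ ≤ℚ p *ℚ r
*-nonNeg {p} {r} 0≤p 0≤r =
  nonNegative⁻¹ (p *ℚ r) {{nonNeg*nonNeg⇒nonNeg p {{nonNegative 0≤p}} r {{nonNegative 0≤r}}}}

+-pos-nonNeg : ∀ {p r} → 0ℚ <ℚ p → 0ℚ ≤ℚ r → 0ℚ <ℚ p + r
+-pos-nonNeg {p} {r} 0<p 0≤r =
  positive⁻¹ (p + r) {{pos+nonNeg⇒pos p {{positive 0<p}} r {{nonNegative 0≤r}}}}

+-nonNeg-pos : ∀ {p r} → 0ℚ ≤ℚ p → 0ℚ <ℚ r → 0ℚ <ℚ p + r
+-nonNeg-pos {p} {r} 0≤p 0<r =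
  positive⁻¹ (p + r) {{nonNeg+pos⇒pos p {{nonNegative 0≤p}} r {{positive 0<r}}}}

+-nonNeg : ∀ {p r} → 0ℚ ≤ℚ p → 0ℚ ≤ℚ r → 0ℚ ≤ℚ p + r
+-nonNeg {p} {r} 0≤p 0≤r =
  nonNegative⁻¹ (p + r) {{nonNeg+nonNeg⇒nonNeg p {{nonNegative 0≤p}} r {{nonNegative 0≤r}}}}

+-pos⇒pos⊎pos : ∀ {p r} → 0ℚ <ℚ p + r → 0ℚ <ℚ p ⊎ 0ℚ <ℚ r
+-pos⇒pos⊎pos {p} {r} 0<p+r with 0ℚ <? p
... | yes 0<p = inj₁ 0<p
... | no  0≮p = inj₂ (<-≤-trans 0<p+r p+r≤r)
  where
  p+r≤r : p + r ≤ℚ r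
  p+r≤r = subst (p + r ≤ℚ_) (+-identityˡ r) (+-monoˡ-≤ r (≮⇒≥ 0≮p))

nonNeg∧*-pos⇒pos : ∀ {p r} → 0ℚ ≤ℚ p → 0ℚ <ℚ p *ℚ r → 0ℚ <ℚ p
nonNeg∧*-pos⇒pos {p} {r} 0≤p 0<pr with 0ℚ <? p
... | yes 0<p = 0<p
... | no  0≮p with ≤-antisym 0≤p (≮⇒≥ 0≮p)
...   | refl = ⊥-elim (<-irrefl (sym (*-zeroˡ r)) 0<pr)

sumFin-nonNeg : (f : Fin n → ℚ) → (∀ i → 0ℚ ≤ℚ f i) → 0ℚ ≤ℚ sumFin n f
sumFin-nonNeg {zero}  f 0≤f = ≤-refl
sumFin-nonNeg {suc n} f 0≤f =
  +-nonNeg (0≤f Fin.zero) (sumFin-nonNeg (λ i → f (Fin.suc i)) (λ i → 0≤f (Fin.suc i)))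

sumFin-pos : (f : Fin n → ℚ) → (∀ i → 0ℚ ≤ℚ f i) → ∀ j → 0ℚ <ℚ f j → 0ℚ <ℚ sumFin n f
sumFin-pos {suc n} f 0≤f Fin.zero    0<fj =
  +-pos-nonNeg 0<fj (sumFin-nonNeg (λ i → f (Fin.suc i)) (λ i → 0≤f (Fin.suc i)))
sumFin-pos {suc n} f 0≤f (Fin.suc j) 0<fj =
  +-nonNeg-pos (0≤f Fin.zero) (sumFin-pos (λ i → f (Fin.suc i)) (λ i → 0≤f (Fin.suc i)) j 0<fj)

sumFin-pos⇒∃pos : (f : Fin n → ℚ) → 0ℚ <ℚ sumFin n f → ∃[ j ] 0ℚ <ℚ f j
sumFin-pos⇒∃pos {zero}  f 0<0 = ⊥-elim (<-irrefl refl 0<0)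
sumFin-pos⇒∃pos {suc n} f 0<sum with +-pos⇒pos⊎pos 0<sum
... | inj₁ 0<f0   = Fin.zero , 0<f0
... | inj₂ 0<rest with sumFin-pos⇒∃pos (λ i → f (Fin.suc i)) 0<rest
...   | j , 0<fj = Fin.suc j , 0<fj

sumVec-nonNeg : (f : Vec (Fin n) d → ℚ) → (∀ v → 0ℚ ≤ℚ f v) → 0ℚ ≤ℚ sumVec n d f
sumVec-nonNeg {d = zero}  f 0≤f = 0≤f []
sumVec-nonNeg {d = suc d} f 0≤f =
  sumFin-nonNeg _ (λ i → sumVec-nonNeg (λ v → f (i ∷ v)) (λ v → 0≤f (i ∷ v)))

sumVec-pos : (f : Vec (Fin n) d → ℚ) → (∀ v → 0ℚ ≤ℚ f v) → ∀ w → 0ℚ <ℚ f w → 0ℚ <ℚ sumVec n d f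
sumVec-pos f 0≤f []      0<fw = 0<fw
sumVec-pos f 0≤f (i ∷ w) 0<fw =
  sumFin-pos _ (λ j → sumVec-nonNeg (λ v → f (j ∷ v)) (λ v → 0≤f (j ∷ v))) i
    (sumVec-pos (λ v → f (i ∷ v)) (λ v → 0≤f (i ∷ v)) w 0<fw)

sumVec-pos⇒∃pos : (f : Vec (Fin n) d → ℚ) → 0ℚ <ℚ sumVec n d f → ∃[ w ] 0ℚ <ℚ f w
sumVec-pos⇒∃pos {d = zero}  f 0<sum = [] , 0<sum
sumVec-pos⇒∃pos {d = suc d} f 0<sum with sumFin-pos⇒∃pos _ 0<sum
... | i , 0<row with sumVec-pos⇒∃pos (λ v → f (i ∷ v)) 0<row
...   | w , 0<fw = i ∷ w , 0<fw

PositiveInEveryRow : Tensor n (suc d) → Set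
PositiveInEveryRow {n} {d} A = ∀ i → ∃[ is ] 0ℚ <ℚ A (i ∷ is)

Positive⇒PositiveInEveryRow : (A : Tensor n (suc d)) → Positive A → PositiveInEveryRow A
Positive⇒PositiveInEveryRow {d = d} A 0<A i = replicate d i , 0<A (i ∷ replicate d i)

prodBlocks-pos : (B : Tensor n (suc q)) → Positive B → ∀ is αs → 0ℚ <ℚ prodBlocks d B is αs
prodBlocks-pos B 0<B []       []       = positive⁻¹ 1ℚ
prodBlocks-pos B 0<B (i ∷ is) (α ∷ αs) = *-pos (0<B (i ∷ α)) (prodBlocks-pos B 0<B is αs)

⊗-positive : (A : Tensor n (suc d)) (B : Tensor n (suc q)) →
             Nonnegative A → PositiveInEveryRow A → Positive B → Positive (A ⊗ B)
⊗-positive {d = d} {q = q} A B 0≤A rows 0<B (i ∷ α) with rows i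
... | is , 0<Ais =
  sumVec-pos _ (λ v → *-nonNeg (0≤A (i ∷ v)) (<⇒≤ℚ (blocks-pos v)))
    is (*-pos 0<Ais (blocks-pos is))
  where
  blocks-pos : ∀ v → 0ℚ <ℚ prodBlocks d B v (chunks d q α)
  blocks-pos v = prodBlocks-pos B 0<B v (chunks d q α)

⊗-PositiveInEveryRow⇒PositiveInEveryRow : (A : Tensor n (suc d)) (B : Tensor n (suc q)) →
  Nonnegative A → PositiveInEveryRow (A ⊗ B) → PositiveInEveryRow A
⊗-PositiveInEveryRow⇒PositiveInEveryRow A B 0≤A rows i with rows i
... | α , 0<ABiα with sumVec-pos⇒∃pos _ 0<ABiα
...   | is , 0<term = is , nonNeg∧*-pos⇒pos (0≤A (i ∷ is)) 0<term

^-positive⇒PositiveInEveryRow : (A : Tensor n (suc d)) → Nonnegative A →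
  ∀ j → Positive (A ^[1+ j ]) → PositiveInEveryRow A
^-positive⇒PositiveInEveryRow A 0≤A zero    0<Aʲ = Positive⇒PositiveInEveryRow A 0<Aʲ
^-positive⇒PositiveInEveryRow A 0≤A (suc j) 0<Aʲ =
  ⊗-PositiveInEveryRow⇒PositiveInEveryRow A (A ^[1+ j ]) 0≤A
    (Positive⇒PositiveInEveryRow (A ^[1+ suc j ]) 0<Aʲ)

^-positive-mono : (A : Tensor n (suc d)) → Nonnegative A → PositiveInEveryRow A →
  ∀ {j j′} → j ≤′ j′ → Positive (A ^[1+ j ]) → Positive (A ^[1+ j′ ])
^-positive-mono A 0≤A rows ≤′-refl        0<Aʲ = 0<Aʲ
^-positive-mono A 0≤A rows (≤′-step j≤j′) 0<Aʲ =
  ⊗-positive A _ 0≤A rows (^-positive-mono A 0≤A rows j≤j′ 0<Aʲ)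

PositivePower-mono : (A : Tensor n (suc d)) → Nonnegative A →
  ∀ {k t} → k ≤ t → PositivePower A k → PositivePower A t
PositivePower-mono A 0≤A {suc j} {suc j′} (s≤s j≤j′) 0<Aᵏ =
  ^-positive-mono A 0≤A (^-positive⇒PositiveInEveryRow A 0≤A j 0<Aᵏ) (≤⇒≤′ j≤j′) 0<Aᵏ

proposition2p11 : (n d : ℕ) → 1 ≤ d → (A : Tensor n (suc d)) →
                    Nonnegative A → StronglyPrimitive A →
                    (k : ℕ) → IsStronglyPrimitiveDegree A k →
                    (t : ℕ) → k < t → PositivePower A t
proposition2p11 n d _ A 0≤A _ k (_ , 0<Aᵏ , _) t k<t = PositivePower-mono A 0≤A (<⇒≤ k<t) 0<Aᵏ
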